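{- Let $T$ be a finite set of tense formulas with $\top,\bot\in T$. For any $n\geq 0$, any formula $\varphi\in T^\Diamond$ and any formula $\psi$: if $\mathsf{G}\vdash\langle\varphi\rangle^{n+2}\Rightarrow_{T^\circ}\psi$, then $\mathsf{G}\vdash\langle\varphi\rangle^{n+3}\Rightarrow_{T^\circ}\psi$.
   Context: Tense formulas are built from a countable set of propositional variables using $\bot,\top$, unary $\neg,\Diamond,\blacksquare$ and binary $\wedge,\vee$; $\Diamond^0\varphi=\varphi$, $\Diamond^{k+1}\varphi=\Diamond\Diamond^k\varphi$. Formula structures: $\langle\varphi\rangle^n$ is the formal expression obtained by applying a unary structural operator $\langle\cdot\rangle$ $n$ times to the formula $\varphi$ ($\langle\varphi\rangle^0=\varphi$); if $\Gamma=\langle\varphi\rangle^n$ then $\langle\Gamma\rangle^k=\langle\varphi\rangle^{n+k}$. A sequent is $\Gamma\Rightarrow\psi$, $\Gamma$ a formula structure, $\psi$ a formula. The calculus $\mathsf{G}$ has axioms (arbitrary formulas, $n\geq0$): $\varphi\Rightarrow\varphi$; $\varphi\wedge(\psi\vee\chi)\Rightarrow(\varphi\wedge\psi)\vee(\varphi\wedge\chi)$; $\varphi\Rightarrow\top$; $\langle\bot\rangle^n\Rightarrow\psi$; $\varphi\wedge\neg\varphi\Rightarrow\bot$; $\top\Rightarrow\varphi\vee\neg\varphi$; $\Diamond^3\varphi\Rightarrow\Diamond^2\varphi$; and rules (arbitrary $n\geq0$): from $\langle\varphi_i\rangle^n\Rightarrow\psi$ infer $\langle\varphi_1\wedge\varphi_2\rangle^n\Rightarrow\psi$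 ($i=1,2$); from $\Gamma\Rightarrow\psi_1$, $\Gamma\Rightarrow\psi_2$ infer $\Gamma\Rightarrow\psi_1\wedge\psi_2$; from $\langle\varphi_1\rangle^n\Rightarrow\psi$, $\langle\varphi_2\rangle^n\Rightarrow\psi$ infer $\langle\varphi_1\vee\varphi_2\rangle^n\Rightarrow\psi$; from $\Gamma\Rightarrow\psi_i$ infer $\Gamma\Rightarrow\psi_1\vee\psi_2$; from $\langle\varphi\rangle^{n+1}\Rightarrow\psi$ infer $\langle\Diamond\varphi\rangle^n\Rightarrow\psi$; from $\Gamma\Rightarrow\psi$ infer $\langle\Gamma\rangle\Rightarrow\Diamond\psi$; from $\langle\varphi\rangle^n\Rightarrow\psi$ infer $\langle\blacksquare\varphi\rangle^{n+1}\Rightarrow\psi$; from $\langle\Gamma\rangle\Rightarrow\psi$ infer $\Gamma\Rightarrow\blacksquare\psi$; from $\Gamma\Rightarrow\varphi$ and $\langle\varphi\rangle^n\Rightarrow\psi$ infer $\langle\Gamma\rangle^n\Rightarrow\psi$ (Cut). A derivation is a finite tree of sequents each node of which is an axiom instance or obtained from its children by a rule. For a finite set $T$ of formulas with $\top,\bot\in T$: $T^\Diamond=\{\Diamond^k\varphi\mid\varphi\in T,\ 0\leq k\leq 3\}$, and $T^\circ$ is the smallest set of formulas containing $T^\Diamond$ and closed under $\neg,\wedge,\vee$. $\mathsf{G}\vdash\Gamma\Rightarrow_{T^\circ}\psi$ means there is a derivation of $\Gamma\Rightarrow\psi$ in $\mathsf{G}$ all of whose formulas belong to $T^\circ$. 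-}

module Defs where

open import Data.Nat using (ℕ; zero; suc; _+_; _≤_)
open import Data.List using (List)
open import Data.List.Membership.Propositional using (_∈_)
open import Data.Product using (Σ; _×_)
open import Relation.Binary.PropositionalEquality using (_≡_)

data Fm : Set where
  var  : ℕ → Fm
  bot  : Fm
  top  : Fm
  neg  : Fm → Fm
  dia  : Fm → Fm
  bbox : Fm → Fm
  _∧_  : Fm → Fm → Fm
  _∨_  : Fm → Fm → Fm

infixr 6 _∧_
infixr 5 _∨_

dia^ : ℕ → Fm → Fm
dia^ zero    φ = φ
dia^ (suc k) φ = dia (dia^ k φ)

-- A formula structure ⟨φ⟩^n is represented by the pair (n, φ);
-- a sequent ⟨φ⟩^n ⇒ ψ is represented by  Der P n φ ψ  below.
-- ⟨⟨φ⟩^m⟩^k = ⟨φ⟩^(m+k).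

-- Derivations in G all of whose formulas satisfy P: every sequent
-- (node) of the tree has its antecedent formula and succedent formula in P.
mutual
  data Der (P : Fm → Set) (n : ℕ) (φ : Fm) (ψ : Fm) : Set where
    node : P φ → P ψ → Step P n φ ψ → Der P n φ ψ

  data Step (P : Fm → Set) : ℕ → Fm → Fm → Set where
    ax-id    : ∀ {φ} → Step P 0 φ φ
    ax-dist  : ∀ {φ ψ χ} → Step P 0 (φ ∧ (ψ ∨ χ)) ((φ ∧ ψ) ∨ (φ ∧ χ))
    ax-top   : ∀ {φ} → Step P 0 φ top
    ax-bot   : ∀ {n ψ} → Step P n bot ψ
    ax-negL  : ∀ {φ} → Step P 0 (φ ∧ neg φ) bot
    ax-negR  : ∀ {φ} → Step P 0 top (φ ∨ neg φ)
    ax-dia32 : ∀ {φ} → Step P 0 (dia^ 3 φ) (dia^ 2 φ)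
    ∧L₁ : ∀ {n φ₁ φ₂ ψ} → Der P n φ₁ ψ → Step P n (φ₁ ∧ φ₂) ψ
    ∧L₂ : ∀ {n φ₁ φ₂ ψ} → Der P n φ₂ ψ → Step P n (φ₁ ∧ φ₂) ψ
    ∧R  : ∀ {n φ ψ₁ ψ₂} → Der P n φ ψ₁ → Der P n φ ψ₂ → Step P n φ (ψ₁ ∧ ψ₂)
    ∨L  : ∀ {n φ₁ φ₂ ψ} → Der P n φ₁ ψ → Der P n φ₂ ψ → Step P n (φ₁ ∨ φ₂) ψ
    ∨R₁ : ∀ {n φ ψ₁ ψ₂} → Der P n φ ψ₁ → Step P n φ (ψ₁ ∨ ψ₂)
    ∨R₂ : ∀ {n φ ψ₁ ψ₂} → Der P n φ ψ₂ → Step P n φ (ψ₁ ∨ ψ₂)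
    ◇L  : ∀ {n φ ψ} → Der P (suc n) φ ψ → Step P n (dia φ) ψ
    ◇R  : ∀ {n φ ψ} → Der P n φ ψ → Step P (suc n) φ (dia ψ)
    ■L  : ∀ {n φ ψ} → Der P n φ ψ → Step P (suc n) (bbox φ) ψ
    ■R  : ∀ {n φ ψ} → Der P (suc n) φ ψ → Step P n φ (bbox ψ)
    cut : ∀ {m n χ φ ψ} → Der P m χ φ → Der P n φ ψ → Step P (m + n) χ ψ

TDia : List Fm → Fm → Set
TDia T φ = Σ Fm λ χ → Σ ℕ λ k → (χ ∈ T) × (k ≤ 3) × (φ ≡ dia^ k χ)

data TCirc (T : List Fm) : Fm → Set where
  base : ∀ {φ} → TDia T φ → TCirc T φ
  cneg : ∀ {φ} → TCirc T φ → TCirc T (neg φ)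
  cand : ∀ {φ ψ} → TCirc T φ → TCirc T ψ → TCirc T (φ ∧ ψ)
  cor  : ∀ {φ ψ} → TCirc T φ → TCirc T ψ → TCirc T (φ ∨ ψ)

DerT : List Fm → ℕ → Fm → Fm → Set
DerT T n φ ψ = Der (TCirc T) n φ ψ

module Submission where

-- Write φ = ◇^k χ with χ ∈ T and k ≤ 3; all of χ, ◇χ, ◇²χ, ◇³χ
-- lie in T°.  Two general facts about G drive the argument.
--  (1) Residuation: ⟨φ⟩^(m+1) ⇒ ψ is derivable iff ⟨◇φ⟩^m ⇒ ψ is (rule ◇L one
--      way, a cut against ⟨φ⟩ ⇒ ◇φ the other way); iterating, ⟨◇^k χ⟩^(j+m) ⇒ ψ
--      iff ⟨◇^(j+k) χ⟩^m ⇒ ψ, as long as the intermediate ◇-powers are allowed.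
--  (2) Stability: if ◇ρ ⇒ ρ is derivable then ⟨ρ⟩^m ⇒ ψ yields ⟨ρ⟩^(m+1) ⇒ ψ
--      and ⟨◇ρ⟩^m ⇒ ψ yields ⟨◇ρ⟩^(m+1) ⇒ ψ.  The axiom ◇³χ ⇒ ◇²χ makes
--      ρ = ◇²χ such a formula.
-- For k = 2, 3 the theorem is (2) directly; for k = 0, 1 we move to ◇²χ by (1),
-- apply (2), and move back.

open import Defs
open import Data.Nat using (ℕ; zero; suc; _+_; _≤_; z≤n; s≤s)
open import Data.Nat.Properties using (+-suc; +-comm; ≤-refl; ≤-trans; n≤1+n)
open import Data.List using (List)
open import Data.List.Membership.Propositional using (_∈_)
open import Data.Product using (_,_)
open import Relation.Binary.PropositionalEquality using (refl; sym; subst)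

module _ {P : Fm → Set} where

  antecedentOk : ∀ {n φ ψ} → Der P n φ ψ → P φ
  antecedentOk (node pφ _ _) = pφ

  succedentOk : ∀ {n φ ψ} → Der P n φ ψ → P ψ
  succedentOk (node _ pψ _) = pψ

  cutDer : ∀ {m n χ φ ψ} → Der P m χ φ → Der P n φ ψ → Der P (m + n) χ ψ
  cutDer d e = node (antecedentOk d) (succedentOk e) (cut d e)

  diaUnit : ∀ {φ} → P φ → P (dia φ) → Der P 1 φ (dia φ)
  diaUnit pφ pdφ = node pφ pdφ (◇R (node pφ pφ ax-id))

  toDia : ∀ {m φ ψ} → P (dia φ) → Der P (suc m) φ ψ → Der P m (dia φ) ψ
  toDia pdφ d = node pdφ (succedentOk d) (◇L d)

  fromDia : ∀ {m φ ψ} → P φ → Der P m (dia φ) ψ → Der P (suc m) φ ψ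
  fromDia pφ d = cutDer (diaUnit pφ (antecedentOk d)) d

  Ladder : Fm → ℕ → Set
  Ladder χ h = ∀ i → i ≤ h → P (dia^ i χ)

  lowerLadder : ∀ {χ h h′} → h′ ≤ h → Ladder χ h → Ladder χ h′
  lowerLadder h′≤h L i i≤h′ = L i (≤-trans i≤h′ h′≤h)

  toDia^ : ∀ {χ ψ} j k {m} → Ladder χ (j + k) →
           Der P (j + m) (dia^ k χ) ψ → Der P m (dia^ (j + k) χ) ψ
  toDia^ zero    k L d = d
  toDia^ {χ} {ψ} (suc j) k {m} L d =
    toDia (L (suc j + k) ≤-refl)
          (toDia^ j k (lowerLadder (n≤1+n _) L)
                  (subst (λ l → Der P l (dia^ k χ) ψ) (sym (+-suc j m)) d))

  fromDia^ : ∀ {χ ψ} j k {m} → Ladder χ (j + k) →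
             Der P m (dia^ (j + k) χ) ψ → Der P (j + m) (dia^ k χ) ψ
  fromDia^ zero    k L d = d
  fromDia^ {χ} {ψ} (suc j) k {m} L d =
    subst (λ l → Der P l (dia^ k χ) ψ) (+-suc j m)
          (fromDia^ j k (lowerLadder (n≤1+n _) L)
                    (fromDia (L (j + k) (n≤1+n _)) d))

  contractDia² : ∀ {χ} → Ladder χ 3 → Der P 0 (dia^ 3 χ) (dia^ 2 χ)
  contractDia² L = node (L 3 ≤-refl) (L 2 (s≤s (s≤s z≤n))) ax-dia32

  stable : ∀ {m ρ ψ} → Der P 0 (dia ρ) ρ → Der P m ρ ψ → Der P (suc m) ρ ψ
  stable contract d = fromDia (succedentOk contract) (cutDer contract d)

  stableDia : ∀ {m ρ ψ} → Der P 0 (dia ρ) ρ → Der P m (dia ρ) ψ → Der P (suc m) (dia ρ) ψ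
  stableDia contract d = cutDer contract (fromDia (succedentOk contract) d)

  addBracket : ∀ {χ ψ} n k → k ≤ 3 → Ladder χ 3 →
               Der P (2 + n) (dia^ k χ) ψ → Der P (3 + n) (dia^ k χ) ψ
  addBracket n 0 _ L d = fromDia^ 2 0 L₂ (stable (contractDia² L) (toDia^ 2 0 L₂ d))
    where L₂ = lowerLadder (s≤s (s≤s z≤n)) L
  addBracket n 1 _ L d = fromDia^ 1 1 L₂ (stable (contractDia² L) (toDia^ 1 1 L₂ d))
    where L₂ = lowerLadder (s≤s (s≤s z≤n)) L
  addBracket n 2 _ L d = stable (contractDia² L) d
  addBracket n 3 _ L d = stableDia (contractDia² L) d
  addBracket n (suc (suc (suc (suc _)))) (s≤s (s≤s (s≤s ()))) L d

lemma3p2 : (T : List Fm) → top ∈ T → bot ∈ T →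
           (n : ℕ) (φ ψ : Fm) → TDia T φ →
           DerT T (n + 2) φ ψ → DerT T (n + 3) φ ψ
lemma3p2 T _ _ n φ ψ (χ , k , χ∈T , k≤3 , refl) d =
  subst (λ l → DerT T l φ ψ) (+-comm 3 n)
    (addBracket n k k≤3 ladder (subst (λ l → DerT T l φ ψ) (+-comm n 2) d))
  where
  ladder : Ladder {TCirc T} χ 3
  ladder i i≤3 = base (χ , i , χ∈T , i≤3 , refl)
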